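{- Let $k \geq 1$ and let $(B,V)$ be a permutation group with $B \notin GR(k)$ such that for every $k$-colored graph $G$ on the vertex set $V$ with $B \subseteq Aut(G)$ there is a permutation $f \in Aut(G)\setminus B$ that preserves every orbit of $B$ (i.e. $f(O)=O$ for each orbit $O$ of $B$). Then $B \oplus C \notin GR(k)$ for every permutation group $C$.
   Context: A $k$-colored graph $G=(V,E)$ consists of a finite set $V$ and a function $E$ from the set of 2-element subsets of $V$ to $\{0,\ldots,k-1\}$ (a complete graph whose edges are colored with at most $k$ colors). An automorphism of $G$ is a permutation $\sigma$ of $V$ with $E(\{\sigma(v),\sigma(w)\})=E(\{v,w\})$ for all $v,w$; $Aut(G)$ denotes the automorphism group, viewed as a permutation group on $V$. Permutation groups are considered up to permutation isomorphism. $GR(k)$ denotes the class of permutation groups $(A,V)$ such that $A=Aut(G)$ for some $k$-colored graph $G$ on $V$. For permutation groups $(A,V)$ and $(C,W)$ with $V\cap W=\emptyset$, the direct sum $A\oplus C$ is the group of pairs $(a,c)$ acting on $V\cup W$ by $(a,c)(x)=a(x)$ for $x\in V$ and $(a,c)(x)=c(x)$ for $x\in W$. -}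

module Defs where

open import Data.Nat using (ℕ; _+_)
open import Data.Fin using (Fin; _↑ˡ_; _↑ʳ_)
open import Data.Fin.Permutation using (Permutation′; _⟨$⟩ʳ_; id; flip; _∘ₚ_)
open import Data.Product using (Σ; ∃; _×_; _,_)
open import Relation.Binary.PropositionalEquality using (_≡_)
open import Relation.Nullary using (¬_)

Perm : ℕ → Set
Perm n = Permutation′ n

_≈ₚ_ : ∀ {n} → Perm n → Perm n → Set
σ ≈ₚ τ = ∀ x → σ ⟨$⟩ʳ x ≡ τ ⟨$⟩ʳ x

record PermGroup (n : ℕ) : Set₁ where
  field
    mem     : Perm n → Set
    mem-resp : ∀ {σ τ} → σ ≈ₚ τ → mem σ → mem τ
    mem-id  : mem id
    mem-∘   : ∀ {σ τ} → mem σ → mem τ → mem (σ ∘ₚ τ)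
    mem-inv : ∀ {σ} → mem σ → mem (flip σ)
open PermGroup public

-- A k-colored graph on Fin n: a symmetric colouring of pairs by Fin k.
-- Only values on 2-element subsets {v,w} (v ≢ w) are meaningful.
record ColGraph (k n : ℕ) : Set where
  field
    E    : Fin n → Fin n → Fin k
    symm : ∀ v w → E v w ≡ E w v
open ColGraph public

IsAut : ∀ {k n} → ColGraph k n → Perm n → Set
IsAut G σ = ∀ v w → ¬ (v ≡ w) → E G (σ ⟨$⟩ʳ v) (σ ⟨$⟩ʳ w) ≡ E G v w

GR : (k : ℕ) → ∀ {n} → (Perm n → Set) → Set
GR k {n} A = Σ (ColGraph k n) λ G → ∀ σ → (A σ → IsAut G σ) × (IsAut G σ → A σ)

SubAut : ∀ {k n} → PermGroup n → ColGraph k n → Set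
SubAut B G = ∀ σ → mem B σ → IsAut G σ

InOrbit : ∀ {n} → PermGroup n → Fin n → Fin n → Set
InOrbit B y x = ∃ λ b → mem B b × (b ⟨$⟩ʳ x ≡ y)

-- f(O) = O for every orbit O of B: for each x, f maps the orbit of x into
-- itself and onto itself.
PreservesOrbits : ∀ {n} → PermGroup n → Perm n → Set
PreservesOrbits B f = ∀ x → InOrbit B (f ⟨$⟩ʳ x) x
                          × (∃ λ z → InOrbit B z x × (f ⟨$⟩ʳ z ≡ x))

-- Direct sum B ⊕ C acting on Fin (n + m) = V ⊔ W
-- (V embedded via _↑ˡ m, W via n ↑ʳ_).
DirectSum : ∀ {n m} → PermGroup n → PermGroup m → Perm (n + m) → Set
DirectSum {n} {m} B C σ =
  ∃ λ a → ∃ λ c → mem B a × mem C c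
    × (∀ x → σ ⟨$⟩ʳ (x ↑ˡ m) ≡ (a ⟨$⟩ʳ x) ↑ˡ m)
    × (∀ y → σ ⟨$⟩ʳ (n ↑ʳ y) ≡ n ↑ʳ (c ⟨$⟩ʳ y))

module Submission where

-- Suppose a colouring G of V ⊔ W (V = Fin n, W = Fin m)
-- had Aut(G) = B ⊕ C.  Every b ∈ B, extended by the identity on W, is then
-- an automorphism of G; hence B ⊆ Aut(G|V) for the induced colouring G|V on
-- V.  The hypothesis yields f ∈ Aut(G|V) ∖ B moving every point within its
-- B-orbit.  Extend f by the identity on W.  Edges inside V are preserved
-- since f ∈ Aut(G|V), edges inside W trivially, and an edge {a, w} with
-- a ∈ V, w ∈ W keeps its colour because f(a) = β(a) for some β ∈ B whose
-- extension is an automorphism of G.  So the extension of f lies in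
-- Aut(G) = B ⊕ C, and its V-component, which is f, lies in B: contradiction.

open import Defs
open import Data.Nat using (ℕ; _≤_; _+_)
open import Data.Product using (∃; _×_; _,_; proj₁; proj₂)
open import Data.Sum using (inj₁; inj₂; _⊎_; map₁)
open import Data.Sum.Properties using (map-map; map₁-cong)
open import Data.Fin using (Fin; _↑ˡ_; _↑ʳ_; splitAt; join)
open import Data.Fin.Properties
  using (splitAt-↑ˡ; splitAt-↑ʳ; splitAt-join; join-splitAt; ↑ˡ-injective)
open import Data.Fin.Permutation using (_⟨$⟩ʳ_; _⟨$⟩ˡ_; permutation; inverseˡ; inverseʳ; id)
open import Function using (_∘_)
open import Relation.Nullary using (¬_)
open import Relation.Binary.PropositionalEquality
  using (_≡_; _≢_; refl; sym; trans; cong; cong₂; subst; module ≡-Reasoning)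

module _ {n m : ℕ} where

  split-cases : (P : Fin (n + m) → Set)
    → (∀ a → P (a ↑ˡ m)) → (∀ b → P (n ↑ʳ b)) → ∀ x → P x
  split-cases P onV onW x = subst P (join-splitAt n m x) (onSum (splitAt n x))
    where
    onSum : (s : Fin n ⊎ Fin m) → P (join n m s)
    onSum (inj₁ a) = onV a
    onSum (inj₂ b) = onW b

  ↑ˡ≢↑ʳ : ∀ {a : Fin n} {b : Fin m} → a ↑ˡ m ≢ n ↑ʳ b
  ↑ˡ≢↑ʳ {a} {b} eq with () ← trans (sym (splitAt-↑ˡ n a m))
                                   (trans (cong (splitAt n) eq) (splitAt-↑ʳ n m b))

  onV : (Fin n → Fin n) → Fin (n + m) → Fin (n + m)
  onV g = join n m ∘ map₁ g ∘ splitAt n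

  onV-↑ˡ : ∀ g a → onV g (a ↑ˡ m) ≡ g a ↑ˡ m
  onV-↑ˡ g a = cong (join n m ∘ map₁ g) (splitAt-↑ˡ n a m)

  onV-↑ʳ : ∀ g b → onV g (n ↑ʳ b) ≡ n ↑ʳ b
  onV-↑ʳ g b = cong (join n m ∘ map₁ g) (splitAt-↑ʳ n m b)

  onV-inverse : ∀ g h → (∀ a → h (g a) ≡ a) → ∀ x → onV h (onV g x) ≡ x
  onV-inverse g h hg≗id x = begin
    join n m (map₁ h (splitAt n (join n m (map₁ g (splitAt n x)))))
      ≡⟨ cong (join n m ∘ map₁ h) (splitAt-join n m (map₁ g (splitAt n x))) ⟩
    join n m (map₁ h (map₁ g (splitAt n x)))
      ≡⟨ cong (join n m) (map-map (splitAt n x)) ⟩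
    join n m (map₁ (h ∘ g) (splitAt n x))
      ≡⟨ cong (join n m) (map₁-cong hg≗id (splitAt n x)) ⟩
    join n m (map₁ (λ a → a) (splitAt n x))
      ≡⟨ cong (join n m) (map₁-identity (splitAt n x)) ⟩
    join n m (splitAt n x)
      ≡⟨ join-splitAt n m x ⟩
    x ∎
    where
    open ≡-Reasoning
    map₁-identity : ∀ (s : Fin n ⊎ Fin m) → map₁ (λ a → a) s ≡ s
    map₁-identity (inj₁ _) = refl
    map₁-identity (inj₂ _) = refl

  extendˡ : Perm n → Perm (n + m)
  extendˡ f = permutation (onV (f ⟨$⟩ʳ_)) (onV (f ⟨$⟩ˡ_))
    (onV-inverse (f ⟨$⟩ˡ_) (f ⟨$⟩ʳ_) (λ _ → inverseʳ f))
    (onV-inverse (f ⟨$⟩ʳ_) (f ⟨$⟩ˡ_) (λ _ → inverseˡ f))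

  extendˡ-↑ˡ : ∀ f a → extendˡ f ⟨$⟩ʳ (a ↑ˡ m) ≡ (f ⟨$⟩ʳ a) ↑ˡ m
  extendˡ-↑ˡ f = onV-↑ˡ (f ⟨$⟩ʳ_)

  extendˡ-↑ʳ : ∀ f b → extendˡ f ⟨$⟩ʳ (n ↑ʳ b) ≡ n ↑ʳ b
  extendˡ-↑ʳ f = onV-↑ʳ (f ⟨$⟩ʳ_)

  extendˡ-∈-⊕ : (B : PermGroup n) (C : PermGroup m)
    → ∀ b → mem B b → DirectSum B C (extendˡ b)
  extendˡ-∈-⊕ B C b b∈B = b , id , b∈B , mem-id C , extendˡ-↑ˡ b , extendˡ-↑ʳ b

  -- Conversely, if the extension of f lies in B ⊕ C then f ∈ B, since the
  -- V-component of an element of B ⊕ C is determined by its action on V.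
  extendˡ-∈-⊕⁻¹ : (B : PermGroup n) (C : PermGroup m)
    → ∀ f → DirectSum B C (extendˡ f) → mem B f
  extendˡ-∈-⊕⁻¹ B C f (a , _ , a∈B , _ , onV≡a , _) = mem-resp B a≈f a∈B
    where
    a≈f : a ≈ₚ f
    a≈f x = ↑ˡ-injective m _ _ (trans (sym (onV≡a x)) (extendˡ-↑ˡ f x))

  restrictˡ : ∀ {k} → ColGraph k (n + m) → ColGraph k n
  restrictˡ G = record
    { E    = λ v w → E G (v ↑ˡ m) (w ↑ˡ m)
    ; symm = λ v w → symm G (v ↑ˡ m) (w ↑ˡ m) }

  restrictˡ-aut : ∀ {k} (G : ColGraph k (n + m)) ρ
    → IsAut G (extendˡ ρ) → IsAut (restrictˡ G) ρ
  restrictˡ-aut G ρ ρ-aut v w v≢w =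
    trans (cong₂ (E G) (sym (extendˡ-↑ˡ ρ v)) (sym (extendˡ-↑ˡ ρ w)))
          (ρ-aut (v ↑ˡ m) (w ↑ˡ m) (v≢w ∘ ↑ˡ-injective m v w))

  extendˡ-aut : ∀ {k} (G : ColGraph k (n + m)) f
    → IsAut (restrictˡ G) f
    → (∀ a → ∃ λ β → IsAut G (extendˡ β) × (β ⟨$⟩ʳ a ≡ f ⟨$⟩ʳ a))
    → IsAut G (extendˡ f)
  extendˡ-aut G f f-aut compatible =
    split-cases (λ v → ∀ w → Preserved v w)
      (λ a → split-cases (Preserved (a ↑ˡ m))
        (λ a′ a≢a′ → trans (cong₂ (E G) (extendˡ-↑ˡ f a) (extendˡ-↑ˡ f a′))
                           (f-aut a a′ (a≢a′ ∘ cong (_↑ˡ m))))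
        (λ b _ → trans (cong₂ (E G) (extendˡ-↑ˡ f a) (extendˡ-↑ʳ f b)) (cross a b)))
      (λ b → split-cases (Preserved (n ↑ʳ b))
        (λ a _ → trans (cong₂ (E G) (extendˡ-↑ʳ f b) (extendˡ-↑ˡ f a))
                       (trans (symm G _ _) (trans (cross a b) (symm G _ _))))
        (λ b′ _ → cong₂ (E G) (extendˡ-↑ʳ f b) (extendˡ-↑ʳ f b′)))
    where
    σ : Perm (n + m)
    σ = extendˡ f

    Preserved : Fin (n + m) → Fin (n + m) → Set
    Preserved v w = v ≢ w → E G (σ ⟨$⟩ʳ v) (σ ⟨$⟩ʳ w) ≡ E G v w

    -- An edge between V and W: f(a) = β(a), and the extension of β fixes
    -- W pointwise and preserves colours.
    cross : ∀ a b → E G ((f ⟨$⟩ʳ a) ↑ˡ m) (n ↑ʳ b) ≡ E G (a ↑ˡ m) (n ↑ʳ b)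
    cross a b with β , β-aut , βa≡fa ← compatible a = begin
      E G ((f ⟨$⟩ʳ a) ↑ˡ m) (n ↑ʳ b)
        ≡⟨ cong₂ (E G) (cong (_↑ˡ m) (sym βa≡fa)) refl ⟩
      E G ((β ⟨$⟩ʳ a) ↑ˡ m) (n ↑ʳ b)
        ≡⟨ cong₂ (E G) (sym (extendˡ-↑ˡ β a)) (sym (extendˡ-↑ʳ β b)) ⟩
      E G (extendˡ β ⟨$⟩ʳ (a ↑ˡ m)) (extendˡ β ⟨$⟩ʳ (n ↑ʳ b))
        ≡⟨ β-aut (a ↑ˡ m) (n ↑ʳ b) ↑ˡ≢↑ʳ ⟩
      E G (a ↑ˡ m) (n ↑ʳ b) ∎
      where open ≡-Reasoning

lemma2p3 : (k : ℕ) → 1 ≤ k → (n : ℕ) → (B : PermGroup n)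
    → ¬ GR k (mem B)
    → (∀ (G : ColGraph k n) → SubAut B G
    → ∃ λ f → IsAut G f × ¬ mem B f × PreservesOrbits B f)
    → (m : ℕ) → (C : PermGroup m) → ¬ GR k (DirectSum B C)
lemma2p3 k _ n B _ hyp m C (G , Aut[G]≡B⊕C) =
  f∉B (extendˡ-∈-⊕⁻¹ B C f (proj₂ (Aut[G]≡B⊕C (extendˡ f)) extendˡf-aut))
  where
  B-aut : ∀ b → mem B b → IsAut G (extendˡ b)
  B-aut b b∈B = proj₁ (Aut[G]≡B⊕C (extendˡ b)) (extendˡ-∈-⊕ B C b b∈B)

  B⊆Aut[G|V] : SubAut B (restrictˡ G)
  B⊆Aut[G|V] b b∈B = restrictˡ-aut G b (B-aut b b∈B)

  witness : ∃ λ f → IsAut (restrictˡ G) f × ¬ mem B f × PreservesOrbits B f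
  witness = hyp (restrictˡ G) B⊆Aut[G|V]

  f : Perm n
  f = proj₁ witness

  f-aut : IsAut (restrictˡ G) f
  f-aut = proj₁ (proj₂ witness)

  f∉B : ¬ mem B f
  f∉B = proj₁ (proj₂ (proj₂ witness))

  f-orbits : PreservesOrbits B f
  f-orbits = proj₂ (proj₂ (proj₂ witness))

  -- f moves each point within its B-orbit, i.e. as some element of B does.
  extendˡf-aut : IsAut G (extendˡ f)
  extendˡf-aut = extendˡ-aut G f f-aut λ a →
    let (β , β∈B , βa≡fa) = proj₁ (f-orbits a) in β , B-aut β β∈B , βa≡fa
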